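{- Let $m,n,r,s\ge1$ be integers such that $m$ divides both $n$ and $s$, and $n$ and $s$ both divide $r$. If $f:\mathbb{Z}/n\mathbb{Z}\to\mathbb{Z}/m\mathbb{Z}$ is congruence preserving, then there exists a congruence preserving function $g:\mathbb{Z}/r\mathbb{Z}\to\mathbb{Z}/s\mathbb{Z}$ such that $\pi_{s,m}\circ g=f\circ\pi_{r,n}$.
   Context: For $j\ge1$: $\pi_j:\mathbb{Z}\to\mathbb{Z}/j\mathbb{Z}$ is the canonical homomorphism; $\iota_j:\mathbb{Z}/j\mathbb{Z}\to\mathbb{N}$ maps a class to its representative in $\{0,\dots,j-1\}$; for $a,b\ge1$, $\pi_{a,b}=\pi_b\circ\iota_a:\mathbb{Z}/a\mathbb{Z}\to\mathbb{Z}/b\mathbb{Z}$. A function $h:\mathbb{Z}/a\mathbb{Z}\to\mathbb{Z}/b\mathbb{Z}$ is congruence preserving if for all $x,y\in\mathbb{Z}/a\mathbb{Z}$, $\pi_{a,b}(x-y)$ divides $h(x)-h(y)$ in $\mathbb{Z}/b\mathbb{Z}$. -}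

module Defs where

open import Data.Nat using (ℕ; _+_; _*_; _∸_; NonZero)
open import Data.Nat.DivMod using (_mod_)
open import Data.Fin using (Fin; toℕ)
open import Data.Product using (∃)
open import Relation.Binary.PropositionalEquality using (_≡_)

-- ℤ/jℤ (j ≥ 1) is modelled as Fin j: a class is identified with its
-- canonical representative in {0,…,j-1}; thus ι_j is toℕ, and the
-- canonical map π_j (restricted to ℕ) is  k ↦ k mod j.

ZMod : ℕ → Set
ZMod j = Fin j

sub : (j : ℕ) .{{_ : NonZero j}} → ZMod j → ZMod j → ZMod j
sub j x y = (toℕ x + (j ∸ toℕ y)) mod j

mul : (j : ℕ) .{{_ : NonZero j}} → ZMod j → ZMod j → ZMod j
mul j x y = (toℕ x * toℕ y) mod j

Divides : (j : ℕ) .{{_ : NonZero j}} → ZMod j → ZMod j → Set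
Divides j d e = ∃ λ (c : ZMod j) → mul j c d ≡ e

πab : (a b : ℕ) .{{_ : NonZero b}} → ZMod a → ZMod b
πab a b x = toℕ x mod b

CongruencePreserving : (a b : ℕ) .{{_ : NonZero a}} .{{_ : NonZero b}} →
  (ZMod a → ZMod b) → Set
CongruencePreserving a b h =
  ∀ (x y : ZMod a) → Divides b (πab a b (sub a x y)) (sub b (h x) (h y))

module Submission where

-- With ι x ∈ ℤ the representative of a class x, a map h : ℤ/aℤ → ℤ/bℤ (b ∣ a)
-- is congruence preserving iff ι (h x) - ι (h y) ∈ (ι x - ι y)ℤ + bℤ for all
-- x, y (cp⇒, ⇒cp).  So with F = ι ∘ f ∘ π_{r,n} on the points of ℤ/rℤ, where
-- F x - F y ∈ (x - y)ℤ + mℤ + sℤ, it suffices to find integers G x with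
-- G x - G y ∈ (x - y)ℤ + sℤ and G x - F x ∈ mℤ + sℤ, and to set g = G mod s.
-- The G x are chosen point by point (lift): each new value solves a pairwise
-- compatible system of congruences, one per earlier point and one for F, by
-- the generalised Chinese remainder theorem, which in turn rests on the
-- identity (Pℤ + I) ∩ (Qℤ + I) = lcm(P,Q)ℤ + I in ℤ (lcm-∩).

open import Defs
open import Data.Nat using (ℕ; NonZero)
open import Data.Nat.Divisibility using (_∣_)
open import Relation.Binary.PropositionalEquality using (_≡_)
open import Data.Product using (Σ; _×_)

open import Data.Nat as ℕ using (_∸_)
import Data.Nat.Properties as ℕₚ
open import Data.Nat.Divisibility using (n∣m⇒m%n≡0)
open import Data.Nat.DivMod using (_%_; _/_; _mod_; m≡m%n+[m/n]*n; m<n⇒m%n≡m; m*[n/m]≡n)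
open import Data.Nat.GCD using (gcd; gcd[m,n]≢0; gcd[m,n]∣m; gcd[m,n]∣n; module Bézout)
open import Data.Nat.Coprimality using (coprime-/gcd; coprime-Bézout)
open import Data.Integer using (ℤ; +_; _+_; _*_; -_; _-_; 0ℤ; 1ℤ; -1ℤ; ∣_∣)
import Data.Integer.Properties as ℤₚ
open import Data.Integer.DivMod using (_%ℕ_; _/ℕ_; a≡a%ℕn+[a/ℕn]*n)
open import Data.Integer.Divisibility.Signed
  using (divides; ∣-refl; ∣-trans; ∣m∣∣m; m∣∣m∣; ∣ᵤ⇒∣; ∣⇒∣ᵤ) renaming (_∣_ to _∣ℤ_)
open import Data.Integer.Tactic.RingSolver using (solve-∀)
open import Data.Fin using (Fin; zero; suc; toℕ)
open import Data.Fin.Properties using (toℕ-fromℕ<; toℕ-injective; toℕ<n)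
open import Data.List using (List; []; _∷_; [_]; _++_)
open import Data.Product using (_,_; proj₁; proj₂)
open import Data.Sum using (inj₁)
open import Function using (_∘_)
open import Level using (0ℓ)
open import Relation.Binary.Bundles using (Setoid)
open import Relation.Binary.PropositionalEquality
  using (refl; sym; trans; cong; subst; module ≡-Reasoning)
import Relation.Binary.Reasoning.Setoid as SetoidReasoning

-- Finitely generated ideals of ℤ

infix  4 _∈⟨_⟩ _≡_mod⟨_⟩ _⊑_
infixr 5 _∷_

-- w ∈⟨ g₁ ∷ … ∷ gₖ ∷ [] ⟩ : w ∈ g₁ℤ + … + gₖℤ.  A proof is the list of
-- coefficients c₁ … cₖ, peeled off one generator at a time.
data _∈⟨_⟩ : ℤ → List ℤ → Set where
  []  : 0ℤ ∈⟨ [] ⟩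
  _∷_ : ∀ {w g gs} (c : ℤ) → w - c * g ∈⟨ gs ⟩ → w ∈⟨ g ∷ gs ⟩

∈⟨⟩-resp : ∀ {gs a b} → a ≡ b → a ∈⟨ gs ⟩ → b ∈⟨ gs ⟩
∈⟨⟩-resp {gs} = subst (_∈⟨ gs ⟩)

∈⟨[]⟩⇒≡0 : ∀ {w} → w ∈⟨ [] ⟩ → w ≡ 0ℤ
∈⟨[]⟩⇒≡0 [] = refl

∈⟨⟩-0 : ∀ {gs} → 0ℤ ∈⟨ gs ⟩
∈⟨⟩-0 {[]}     = []
∈⟨⟩-0 {g ∷ gs} = 0ℤ ∷ ∈⟨⟩-resp (lemma g) ∈⟨⟩-0
  where lemma : ∀ g → 0ℤ ≡ 0ℤ - 0ℤ * g
        lemma = solve-∀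

∈⟨⟩-+ : ∀ {gs a b} → a ∈⟨ gs ⟩ → b ∈⟨ gs ⟩ → a + b ∈⟨ gs ⟩
∈⟨⟩-+ []                                []       = []
∈⟨⟩-+ {g ∷ gs} {a} {b} (c ∷ a′) (d ∷ b′) = c + d ∷ ∈⟨⟩-resp (lemma a b c d g) (∈⟨⟩-+ a′ b′)
  where lemma : ∀ a b c d g → (a - c * g) + (b - d * g) ≡ (a + b) - (c + d) * g
        lemma = solve-∀

∈⟨⟩-* : ∀ {gs a} k → a ∈⟨ gs ⟩ → k * a ∈⟨ gs ⟩
∈⟨⟩-* k [] = ∈⟨⟩-resp (sym (ℤₚ.*-zeroʳ k)) []
∈⟨⟩-* {g ∷ gs} {a} k (c ∷ a′) = k * c ∷ ∈⟨⟩-resp (lemma k a c g) (∈⟨⟩-* k a′)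
  where lemma : ∀ k a c g → k * (a - c * g) ≡ k * a - (k * c) * g
        lemma = solve-∀

∣⇒∈⟨⟩ : ∀ {K g w} → g ∣ℤ w → w ∈⟨ g ∷ K ⟩
∣⇒∈⟨⟩ {K} {g} (divides q refl) = q ∷ ∈⟨⟩-resp (sym (ℤₚ.+-inverseʳ (q * g))) ∈⟨⟩-0

∈⟨⟩-rescale : ∀ {K g ℓ w} k → k * g ≡ ℓ → w ∈⟨ g ∷ K ⟩ → k * w ∈⟨ ℓ ∷ K ⟩
∈⟨⟩-rescale {K} {g} {w = w} k refl (c ∷ w′) = c ∷ ∈⟨⟩-resp (lemma k w c g) (∈⟨⟩-* k w′)
  where lemma : ∀ k w c g → k * (w - c * g) ≡ k * w - c * (k * g)
        lemma = solve-∀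

_⊑_ : List ℤ → List ℤ → Set
gs ⊑ hs = ∀ {w} → w ∈⟨ gs ⟩ → w ∈⟨ hs ⟩

⊑-++ : ∀ {gs hs} → gs ⊑ gs ++ hs
⊑-++ []       = ∈⟨⟩-0
⊑-++ (c ∷ w′) = c ∷ ⊑-++ w′

⊑-cons : ∀ {K g} → K ⊑ g ∷ K
⊑-cons {K} {g} {w} w∈K = 0ℤ ∷ ∈⟨⟩-resp (lemma w g) w∈K
  where lemma : ∀ w g → w ≡ w - 0ℤ * g
        lemma = solve-∀

⊑-insert : ∀ {K g h} → g ∷ K ⊑ g ∷ h ∷ K
⊑-insert (c ∷ w′) = c ∷ ⊑-cons w′

⊑-swap : ∀ {K g h} → g ∷ h ∷ K ⊑ h ∷ g ∷ K
⊑-swap {K} {g} {h} {w} (c ∷ d ∷ w′) = d ∷ c ∷ ∈⟨⟩-resp (lemma w c g d h) w′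
  where lemma : ∀ w c g d h → w - c * g - d * h ≡ w - d * h - c * g
        lemma = solve-∀

⊑-head-∣ : ∀ {K g h} → h ∣ℤ g → g ∷ K ⊑ h ∷ K
⊑-head-∣ {K} {g} {h} (divides q refl) {w} (c ∷ w′) = c * q ∷ ∈⟨⟩-resp (lemma w c q h) w′
  where lemma : ∀ w c q h → w - c * (q * h) ≡ w - c * q * h
        lemma = solve-∀

⊑-absorb : ∀ {K g h} → g ∣ℤ h → g ∷ h ∷ K ⊑ g ∷ K
⊑-absorb {K} {g} {h} (divides q refl) {w} (c ∷ d ∷ w′) =
  c + d * q ∷ ∈⟨⟩-resp (lemma w c d q g) w′
  where lemma : ∀ w c d q g → w - c * g - d * (q * g) ≡ w - (c + d * q) * g
        lemma = solve-∀

⊑-difference : ∀ {K a b} → b - a ∷ K ⊑ a ∷ b ∷ K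
⊑-difference {K} {a} {b} {w} (c ∷ w′) = - c ∷ c ∷ ∈⟨⟩-resp (lemma w c a b) w′
  where lemma : ∀ w c a b → w - c * (b - a) ≡ w - (- c) * a - c * b
        lemma = solve-∀

-- a ≡ b mod⟨ gs ⟩ : a - b ∈⟨ gs ⟩.  A record rather than an abbreviation, so
-- that a and b can be inferred from the type.
record _≡_mod⟨_⟩ (a b : ℤ) (gs : List ℤ) : Set where
  constructor by-difference
  field difference : a - b ∈⟨ gs ⟩
open _≡_mod⟨_⟩ public

mod-mono : ∀ {gs hs a b} → gs ⊑ hs → a ≡ b mod⟨ gs ⟩ → a ≡ b mod⟨ hs ⟩
mod-mono gs⊑hs (by-difference a-b) = by-difference (gs⊑hs a-b)

mod-refl : ∀ {gs a} → a ≡ a mod⟨ gs ⟩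
mod-refl {gs} {a} = by-difference (∈⟨⟩-resp (sym (ℤₚ.+-inverseʳ a)) ∈⟨⟩-0)

mod-sym : ∀ {gs a b} → a ≡ b mod⟨ gs ⟩ → b ≡ a mod⟨ gs ⟩
mod-sym {gs} {a} {b} (by-difference a-b) = by-difference (∈⟨⟩-resp (lemma a b) (∈⟨⟩-* -1ℤ a-b))
  where lemma : ∀ a b → -1ℤ * (a - b) ≡ b - a
        lemma = solve-∀

mod-trans : ∀ {gs a b c} → a ≡ b mod⟨ gs ⟩ → b ≡ c mod⟨ gs ⟩ → a ≡ c mod⟨ gs ⟩
mod-trans {gs} {a} {b} {c} (by-difference a-b) (by-difference b-c) =
  by-difference (∈⟨⟩-resp (lemma a b c) (∈⟨⟩-+ a-b b-c))
  where lemma : ∀ a b c → (a - b) + (b - c) ≡ a - c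
        lemma = solve-∀

mod-setoid : List ℤ → Setoid 0ℓ 0ℓ
mod-setoid gs = record
  { Carrier       = ℤ
  ; _≈_           = λ a b → a ≡ b mod⟨ gs ⟩
  ; isEquivalence = record { refl = mod-refl ; sym = mod-sym ; trans = mod-trans }
  }

mod-* : ∀ {gs a a′ b b′} → a ≡ a′ mod⟨ gs ⟩ → b ≡ b′ mod⟨ gs ⟩ → a * b ≡ a′ * b′ mod⟨ gs ⟩
mod-* {gs} {a} {a′} {b} {b′} (by-difference a-a′) (by-difference b-b′) =
  by-difference (∈⟨⟩-resp (lemma a a′ b b′) (∈⟨⟩-+ (∈⟨⟩-* b a-a′) (∈⟨⟩-* a′ b-b′)))
  where lemma : ∀ a a′ b b′ → b * (a - a′) + a′ * (b - b′) ≡ a * b - a′ * b′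
        lemma = solve-∀

mod-− : ∀ {gs a a′ b b′} → a ≡ a′ mod⟨ gs ⟩ → b ≡ b′ mod⟨ gs ⟩ → a - b ≡ a′ - b′ mod⟨ gs ⟩
mod-− {gs} {a} {a′} {b} {b′} (by-difference a-a′) (by-difference b-b′) =
  by-difference (∈⟨⟩-resp (lemma a a′ b b′) (∈⟨⟩-+ a-a′ (∈⟨⟩-* -1ℤ b-b′)))
  where lemma : ∀ a a′ b b′ → (a - a′) + -1ℤ * (b - b′) ≡ (a - b) - (a′ - b′)
        lemma = solve-∀

mod-+∈ : ∀ {gs a w} → w ∈⟨ gs ⟩ → a + w ≡ a mod⟨ gs ⟩
mod-+∈ {gs} {a} {w} w∈ = by-difference (∈⟨⟩-resp (lemma a w) w∈)
  where lemma : ∀ a w → w ≡ a + w - a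
        lemma = solve-∀

⊑-head-≡ : ∀ {K g g′} → g ≡ g′ mod⟨ K ⟩ → g ∷ K ⊑ g′ ∷ K
⊑-head-≡ {K} {g} {g′} (by-difference g-g′) {w} (c ∷ w′) =
  c ∷ ∈⟨⟩-resp (lemma w c g g′) (∈⟨⟩-+ w′ (∈⟨⟩-* c g-g′))
  where lemma : ∀ w c g g′ → w - c * g + c * (g - g′) ≡ w - c * g′
        lemma = solve-∀

-- Least common multiples and intersections of ideals

-- ℓ is a common multiple Q′ P = ℓ = P′ Q whose cofactors P′, Q′ are coprime,
-- witnessed by a Bézout identity; such an ℓ is an lcm of P and Q.
record Lcm (P Q : ℤ) : Set where
  field
    ℓ P′ Q′ σ τ : ℤ
    Q′P≡ℓ       : Q′ * P ≡ ℓ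
    P′Q≡ℓ       : P′ * Q ≡ ℓ
    coprime     : σ * P′ + τ * Q′ ≡ 1ℤ

bézout-ℤ : ∀ {a b} → Bézout.Identity 1 a b → Σ ℤ λ σ → Σ ℤ λ τ → σ * + a + τ * + b ≡ 1ℤ
bézout-ℤ {a} {b} (Bézout.+- x y eq) = + x , - + y , (begin
    + x * + a + - + y * + b         ≡⟨ cong (_+ - + y * + b) eq-ℤ ⟨
    1ℤ + + y * + b + - + y * + b    ≡⟨ lemma (+ y) (+ b) ⟩
    1ℤ                              ∎)
  where
  open ≡-Reasoning
  eq-ℤ : 1ℤ + + y * + b ≡ + x * + a
  eq-ℤ = begin
    1ℤ + + y * + b     ≡⟨ cong (λ t → 1ℤ + t) (ℤₚ.pos-* y b) ⟨
    + (1 ℕ.+ y ℕ.* b)  ≡⟨ cong +_ eq ⟩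
    + (x ℕ.* a)        ≡⟨ ℤₚ.pos-* x a ⟩
    + x * + a          ∎
  lemma : ∀ y b → 1ℤ + y * b + - y * b ≡ 1ℤ
  lemma = solve-∀
bézout-ℤ {a} {b} (Bézout.-+ x y eq) with bézout-ℤ (Bézout.+- y x eq)
... | σ , τ , eq′ = τ , σ , trans (ℤₚ.+-comm (τ * + a) (σ * + b)) eq′

-- Every two natural numbers have an lcm: divide both by their gcd.
lcm-exists : ∀ P Q → Lcm (+ P) (+ Q)
lcm-exists ℕ.zero Q = record
  { ℓ = 0ℤ ; P′ = 0ℤ ; Q′ = 1ℤ ; σ = 0ℤ ; τ = 1ℤ
  ; Q′P≡ℓ = refl ; P′Q≡ℓ = refl ; coprime = refl }
lcm-exists P@(ℕ.suc _) Q = record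
  { ℓ = + (P ℕ.* Q′) ; P′ = + P′ ; Q′ = + Q′ ; σ = σ ; τ = τ
  ; Q′P≡ℓ = trans (sym (ℤₚ.pos-* Q′ P)) (cong +_ (ℕₚ.*-comm Q′ P))
  ; P′Q≡ℓ = trans (sym (ℤₚ.pos-* P′ Q)) (cong +_ P′Q≡PQ′)
  ; coprime = coprime }
  where
  open ≡-Reasoning
  g = gcd P Q
  instance
    g≢0 : NonZero g
    g≢0 = ℕ.≢-nonZero (gcd[m,n]≢0 P Q (inj₁ λ ()))
  P′ Q′ : ℕ
  P′ = P / g
  Q′ = Q / g
  P′Q≡PQ′ : P′ ℕ.* Q ≡ P ℕ.* Q′
  P′Q≡PQ′ = begin
    P′ ℕ.* Q             ≡⟨ cong (P′ ℕ.*_) (m*[n/m]≡n (gcd[m,n]∣n P Q)) ⟨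
    P′ ℕ.* (g ℕ.* Q′)    ≡⟨ ℕₚ.*-assoc P′ g Q′ ⟨
    (P′ ℕ.* g) ℕ.* Q′    ≡⟨ cong (ℕ._* Q′) (ℕₚ.*-comm P′ g) ⟩
    (g ℕ.* P′) ℕ.* Q′    ≡⟨ cong (ℕ._* Q′) (m*[n/m]≡n (gcd[m,n]∣m P Q)) ⟩
    P ℕ.* Q′             ∎
  σ,τ = bézout-ℤ (coprime-Bézout (coprime-/gcd P Q))
  σ τ : ℤ
  σ = proj₁ σ,τ
  τ = proj₁ (proj₂ σ,τ)
  coprime : σ * + P′ + τ * + Q′ ≡ 1ℤ
  coprime = proj₂ (proj₂ σ,τ)

-- (Pℤ + ⟨K⟩) ∩ (Qℤ + ⟨K⟩) ⊆ ℓℤ + ⟨K⟩ : write w = σ (P′ w) + τ (Q′ w).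
lcm-∩ : ∀ {P Q K w} (L : Lcm P Q) → w ∈⟨ P ∷ K ⟩ → w ∈⟨ Q ∷ K ⟩ → w ∈⟨ Lcm.ℓ L ∷ K ⟩
lcm-∩ {w = w} L w∈P w∈Q =
  ∈⟨⟩-resp decomposition
    (∈⟨⟩-+ (∈⟨⟩-* σ (∈⟨⟩-rescale P′ P′Q≡ℓ w∈Q)) (∈⟨⟩-* τ (∈⟨⟩-rescale Q′ Q′P≡ℓ w∈P)))
  where
  open Lcm L
  open ≡-Reasoning
  decomposition : σ * (P′ * w) + τ * (Q′ * w) ≡ w
  decomposition = begin
    σ * (P′ * w) + τ * (Q′ * w)  ≡⟨ lemma σ P′ τ Q′ w ⟩
    (σ * P′ + τ * Q′) * w        ≡⟨ cong (_* w) coprime ⟩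
    1ℤ * w                       ≡⟨ ℤₚ.*-identityˡ w ⟩
    w                            ∎
    where lemma : ∀ σ P′ τ Q′ w → σ * (P′ * w) + τ * (Q′ * w) ≡ (σ * P′ + τ * Q′) * w
          lemma = solve-∀

record FamilyLcm {N} (d : Fin N → ℤ) : Set where
  field
    L        : ℤ
    multiple : ∀ k → d k ∣ℤ L
    ∩⊆       : ∀ {K w} → (∀ k → w ∈⟨ d k ∷ K ⟩) → w ∈⟨ L ∷ K ⟩

family-lcm : ∀ {N} (d : Fin N → ℤ) → FamilyLcm d
family-lcm {ℕ.zero} d = record
  { L        = 1ℤ
  ; multiple = λ ()
  ; ∩⊆       = λ {_} {w} _ → ∣⇒∈⟨⟩ (divides w (sym (ℤₚ.*-identityʳ w)))
  }
family-lcm {ℕ.suc N} d = record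
  { L        = ℓ
  ; multiple = λ where
      zero    → ∣-trans m∣∣m∣ (divides P′ (sym P′Q≡ℓ))
      (suc k) → ∣-trans (multiple k) (∣-trans m∣∣m∣ (divides Q′ (sym Q′P≡ℓ)))
  ; ∩⊆       = λ w∈ → lcm-∩ lcm (⊑-head-∣ ∣m∣∣m (∩⊆ (w∈ ∘ suc))) (⊑-head-∣ ∣m∣∣m (w∈ zero))
  }
  where
  open FamilyLcm (family-lcm (d ∘ suc))
  lcm : Lcm (+ ∣ L ∣) (+ ∣ d zero ∣)
  lcm = lcm-exists ∣ L ∣ ∣ d zero ∣
  open Lcm lcm

-- The generalised Chinese remainder theorem

-- Solve the last N congruences by v; since a₀ - v lies in
-- every d k ℤ + d₀ ℤ + ⟨J⟩, it lies in Lℤ + d₀ℤ + ⟨J⟩ for the lcm L of the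
-- d k, i.e. a₀ - v = α L + (element of d₀ℤ + ⟨J⟩); then v + α L solves all.
chinese-remainder : ∀ {N} J (a d : Fin N → ℤ) →
  (∀ k k′ → a k ≡ a k′ mod⟨ d k ∷ d k′ ∷ J ⟩) →
  Σ ℤ λ v → ∀ k → v ≡ a k mod⟨ d k ∷ J ⟩
chinese-remainder {ℕ.zero}  J a d compatible = 0ℤ , λ ()
chinese-remainder {ℕ.suc N} J a d compatible = extend (∩⊆ (difference ∘ a₀≡v))
  where
  open FamilyLcm (family-lcm (d ∘ suc))
  solution = chinese-remainder J (a ∘ suc) (d ∘ suc) (λ k k′ → compatible (suc k) (suc k′))
  v : ℤ
  v = proj₁ solution
  v≡a : ∀ k → v ≡ a (suc k) mod⟨ d (suc k) ∷ J ⟩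
  v≡a = proj₂ solution
  a₀≡v : ∀ k → a zero ≡ v mod⟨ d (suc k) ∷ d zero ∷ J ⟩
  a₀≡v k = mod-trans (mod-sym (compatible (suc k) zero)) (mod-sym (mod-mono ⊑-insert (v≡a k)))
  extend : a zero - v ∈⟨ L ∷ d zero ∷ J ⟩ → Σ ℤ λ v′ → ∀ k → v′ ≡ a k mod⟨ d k ∷ J ⟩
  extend (α ∷ rest) = v + α * L , λ where
      zero    → mod-sym (by-difference (∈⟨⟩-resp (lemma (a zero) v α L) rest))
      (suc k) → mod-trans (mod-+∈ (∈⟨⟩-* α (∣⇒∈⟨⟩ (multiple k)))) (v≡a k)
    where lemma : ∀ a v α L → a - v - α * L ≡ a - (v + α * L)
          lemma = solve-∀

-- Lifting, one point at a time

-- The value at the first point is chosen, by the Chinese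
-- remainder theorem, congruent to F there modulo (m, J) and to the values
-- already constructed modulo (p₀ - p k, J); the hypothesis on F makes these
-- congruences pairwise compatible.
lift : ∀ {N} (m : ℤ) (J : List ℤ) (p F : Fin N → ℤ) →
  (∀ i j → F i ≡ F j mod⟨ p i - p j ∷ m ∷ J ⟩) →
  Σ (Fin N → ℤ) λ G → (∀ i j → G i ≡ G j mod⟨ p i - p j ∷ J ⟩) × (∀ i → G i ≡ F i mod⟨ m ∷ J ⟩)
lift {ℕ.zero}  m J p F F≡F = (λ ()) , (λ ()) , (λ ())
lift {ℕ.suc N} m J p F F≡F = G , G≡G , G≡F
  where
  lifted = lift m J (p ∘ suc) (F ∘ suc) (λ i j → F≡F (suc i) (suc j))
  G₀ : Fin N → ℤ
  G₀ = proj₁ lifted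
  G₀≡G₀ : ∀ i j → G₀ i ≡ G₀ j mod⟨ p (suc i) - p (suc j) ∷ J ⟩
  G₀≡G₀ = proj₁ (proj₂ lifted)
  G₀≡F : ∀ i → G₀ i ≡ F (suc i) mod⟨ m ∷ J ⟩
  G₀≡F = proj₂ (proj₂ lifted)
  a d : Fin (ℕ.suc N) → ℤ
  a zero    = F zero
  a (suc k) = G₀ k
  d zero    = m
  d (suc k) = p zero - p (suc k)
  F₀≡G₀ : ∀ k → F zero ≡ G₀ k mod⟨ m ∷ d (suc k) ∷ J ⟩
  F₀≡G₀ k = mod-trans (mod-mono ⊑-swap (F≡F zero (suc k))) (mod-mono ⊑-insert (mod-sym (G₀≡F k)))
  compatible : ∀ k k′ → a k ≡ a k′ mod⟨ d k ∷ d k′ ∷ J ⟩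
  compatible zero    zero     = mod-refl
  compatible zero    (suc k′) = F₀≡G₀ k′
  compatible (suc k) zero     = mod-mono ⊑-swap (mod-sym (F₀≡G₀ k))
  compatible (suc k) (suc k′) = mod-mono ⊑-difference
      (subst (λ g → G₀ k ≡ G₀ k′ mod⟨ g ∷ J ⟩) (lemma (p zero) (p (suc k)) (p (suc k′))) (G₀≡G₀ k k′))
    where lemma : ∀ x y z → y - z ≡ (x - z) - (x - y)
          lemma = solve-∀
  solution = chinese-remainder J a d compatible
  v : ℤ
  v = proj₁ solution
  v≡a : ∀ k → v ≡ a k mod⟨ d k ∷ J ⟩
  v≡a = proj₂ solution
  G : Fin (ℕ.suc N) → ℤ
  G zero    = v
  G (suc k) = G₀ k
  G≡G : ∀ i j → G i ≡ G j mod⟨ p i - p j ∷ J ⟩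
  G≡G zero    zero    = mod-refl
  G≡G zero    (suc j) = v≡a (suc j)
  G≡G (suc i) zero    =
    mod-mono (⊑-head-∣ (divides -1ℤ (lemma (p zero) (p (suc i))))) (mod-sym (v≡a (suc i)))
    where lemma : ∀ x y → x - y ≡ -1ℤ * (y - x)
          lemma = solve-∀
  G≡G (suc i) (suc j) = G₀≡G₀ i j
  G≡F : ∀ i → G i ≡ F i mod⟨ m ∷ J ⟩
  G≡F zero    = v≡a zero
  G≡F (suc i) = G₀≡F i

-- The dictionary between ℤ/jℤ and congruences in ℤ

ι : ∀ {j} → ZMod j → ℤ
ι x = + toℕ x

reduce : ∀ j .{{_ : NonZero j}} → ℤ → ZMod j
reduce j z = (z %ℕ j) mod j

mod-∣ : ∀ {a b x y} → b ∣ a → x ≡ y mod⟨ [ + a ] ⟩ → x ≡ y mod⟨ [ + b ] ⟩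
mod-∣ b∣a = mod-mono (⊑-head-∣ (∣ᵤ⇒∣ b∣a))

module _ {j : ℕ} .{{_ : NonZero j}} where
  open SetoidReasoning (mod-setoid [ + j ])

  ι-mod : ∀ k → ι (k mod j) ≡ + k mod⟨ [ + j ] ⟩
  ι-mod k = begin
    ι (k mod j)                    ≡⟨ cong +_ (toℕ-fromℕ< _) ⟩
    + (k % j)                      ≈⟨ mod-+∈ (∣⇒∈⟨⟩ (divides (+ (k / j)) refl)) ⟨
    + (k % j) + + (k / j) * + j    ≡⟨ cong (λ t → + (k % j) + t) (ℤₚ.pos-* (k / j) j) ⟨
    + (k % j) + + (k / j ℕ.* j)    ≡⟨ ℤₚ.pos-+ (k % j) (k / j ℕ.* j) ⟨
    + (k % j ℕ.+ k / j ℕ.* j)      ≡⟨ cong +_ (m≡m%n+[m/n]*n k j) ⟨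
    + k                            ∎

  ι-reduce : ∀ z → ι (reduce j z) ≡ z mod⟨ [ + j ] ⟩
  ι-reduce z = begin
    ι (reduce j z)                 ≈⟨ ι-mod (z %ℕ j) ⟩
    + (z %ℕ j)                     ≈⟨ mod-+∈ (∣⇒∈⟨⟩ (divides (z /ℕ j) refl)) ⟨
    + (z %ℕ j) + (z /ℕ j) * + j    ≡⟨ a≡a%ℕn+[a/ℕn]*n z j ⟨
    z                              ∎

  ι-πab : ∀ {a} (x : ZMod a) → ι (πab a j x) ≡ ι x mod⟨ [ + j ] ⟩
  ι-πab x = ι-mod (toℕ x)

  ι-mul : ∀ x y → ι (mul j x y) ≡ ι x * ι y mod⟨ [ + j ] ⟩
  ι-mul x y = begin
    ι (mul j x y)          ≈⟨ ι-mod (toℕ x ℕ.* toℕ y) ⟩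
    + (toℕ x ℕ.* toℕ y)    ≡⟨ ℤₚ.pos-* (toℕ x) (toℕ y) ⟩
    ι x * ι y              ∎

  ι-sub : ∀ x y → ι (sub j x y) ≡ ι x - ι y mod⟨ [ + j ] ⟩
  ι-sub x y = begin
    ι (sub j x y)                ≈⟨ ι-mod (toℕ x ℕ.+ (j ∸ toℕ y)) ⟩
    + (toℕ x ℕ.+ (j ∸ toℕ y))    ≡⟨ ℤₚ.pos-+ (toℕ x) (j ∸ toℕ y) ⟩
    ι x + + (j ∸ toℕ y)          ≡⟨ cong (λ t → ι x + t) j∸y ⟩
    ι x + (+ j - ι y)            ≡⟨ lemma (ι x) (+ j) (ι y) ⟩
    ι x - ι y + + j              ≈⟨ mod-+∈ (∣⇒∈⟨⟩ ∣-refl) ⟩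
    ι x - ι y                    ∎
    where
    j∸y : + (j ∸ toℕ y) ≡ + j - ι y
    j∸y = trans (sym (ℤₚ.⊖-≥ (ℕₚ.<⇒≤ (toℕ<n y)))) (sym (ℤₚ.m-n≡m⊖n j (toℕ y)))
    lemma : ∀ x j y → x + (j - y) ≡ x - y + j
    lemma = solve-∀

  -- ι x - ι y is a multiple of j of absolute value < j, hence 0
  ι-injective-mod : ∀ {x y : ZMod j} → ι x ≡ ι y mod⟨ [ + j ] ⟩ → x ≡ y
  ι-injective-mod {x} {y} (by-difference (q ∷ rest)) =
    toℕ-injective (ℤₚ.+-injective (ℤₚ.i-j≡0⇒i≡j _ _ (ℤₚ.∣i∣≡0⇒i≡0 ∣x-y∣≡0)))
    where
    j∣x-y : j ∣ ∣ ι x - ι y ∣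
    j∣x-y = ∣⇒∣ᵤ {+ j} {ι x - ι y} (divides q (ℤₚ.i-j≡0⇒i≡j _ _ (∈⟨[]⟩⇒≡0 rest)))
    x-y<j : ∣ ι x - ι y ∣ ℕ.< j
    x-y<j = subst (ℕ._< j) (cong ∣_∣ (sym (ℤₚ.m-n≡m⊖n (toℕ x) (toℕ y))))
              (ℕₚ.≤-<-trans (ℤₚ.∣m⊝n∣≤m⊔n (toℕ x) (toℕ y)) (ℕₚ.⊔-lub (toℕ<n x) (toℕ<n y)))
    ∣x-y∣≡0 : ∣ ι x - ι y ∣ ≡ 0
    ∣x-y∣≡0 = trans (sym (m<n⇒m%n≡m x-y<j)) (n∣m⇒m%n≡0 _ j j∣x-y)

module _ {a b : ℕ} .{{_ : NonZero a}} .{{_ : NonZero b}} (b∣a : b ∣ a) where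
  open SetoidReasoning (mod-setoid [ + b ])

  πab-sub : ∀ x y → ι (πab a b (sub a x y)) ≡ ι x - ι y mod⟨ [ + b ] ⟩
  πab-sub x y = mod-trans (ι-πab (sub a x y)) (mod-∣ b∣a (ι-sub x y))

  cp⇒ : ∀ h → CongruencePreserving a b h →
        ∀ x y → ι (h x) ≡ ι (h y) mod⟨ ι x - ι y ∷ [ + b ] ⟩
  cp⇒ h cp x y with cp x y
  ... | c , c*d≡e = by-difference (ι c ∷ difference (begin
    ι (h x) - ι (h y)                    ≈⟨ ι-sub (h x) (h y) ⟨
    ι (sub b (h x) (h y))                ≡⟨ cong ι c*d≡e ⟨
    ι (mul b c (πab a b (sub a x y)))    ≈⟨ ι-mul c (πab a b (sub a x y)) ⟩
    ι c * ι (πab a b (sub a x y))        ≈⟨ mod-* (mod-refl {a = ι c}) (πab-sub x y) ⟩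
    ι c * (ι x - ι y)                    ∎))

  ⇒cp : ∀ h → (∀ x y → ι (h x) ≡ ι (h y) mod⟨ ι x - ι y ∷ [ + b ] ⟩) →
        CongruencePreserving a b h
  ⇒cp h h≡h x y with h≡h x y
  ... | by-difference (α ∷ rest) = reduce b α , ι-injective-mod (begin
    ι (mul b (reduce b α) (πab a b (sub a x y)))   ≈⟨ ι-mul (reduce b α) (πab a b (sub a x y)) ⟩
    ι (reduce b α) * ι (πab a b (sub a x y))       ≈⟨ mod-* (ι-reduce α) (πab-sub x y) ⟩
    α * (ι x - ι y)                                ≈⟨ by-difference rest ⟨
    ι (h x) - ι (h y)                              ≈⟨ ι-sub (h x) (h y) ⟨
    ι (sub b (h x) (h y))                          ∎)

precompose : ∀ {m n r} .{{_ : NonZero m}} .{{_ : NonZero n}} .{{_ : NonZero r}} →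
  m ∣ n → n ∣ r → ∀ (f : ZMod n → ZMod m) → CongruencePreserving n m f →
  ∀ x y → ι (f (πab r n x)) ≡ ι (f (πab r n y)) mod⟨ ι x - ι y ∷ [ + m ] ⟩
precompose {m} {n} {r} m∣n n∣r f cpf x y =
  mod-mono (⊑-head-≡ (mod-∣ m∣n π-difference)) (cp⇒ m∣n f cpf (πab r n x) (πab r n y))
  where π-difference : ι (πab r n x) - ι (πab r n y) ≡ ι x - ι y mod⟨ [ + n ] ⟩
        π-difference = mod-− (ι-πab x) (ι-πab y)

corollary14 : (m n r s : ℕ) .{{_ : NonZero m}} .{{_ : NonZero n}}
      .{{_ : NonZero r}} .{{_ : NonZero s}} →
    m ∣ n → m ∣ s → n ∣ r → s ∣ r →
    (f : ZMod n → ZMod m) → CongruencePreserving n m f →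
    Σ (ZMod r → ZMod s) λ g → CongruencePreserving r s g ×
      (∀ (x : ZMod r) → πab s m (g x) ≡ f (πab r n x))
corollary14 m n r s m∣n m∣s n∣r s∣r f cpf = g , ⇒cp s∣r g g≡g , g-lifts-f
  where
  F : ZMod r → ℤ
  F x = ι (f (πab r n x))
  lifted = lift (+ m) [ + s ] ι F (λ x y → mod-mono ⊑-++ (precompose m∣n n∣r f cpf x y))
  G : ZMod r → ℤ
  G = proj₁ lifted
  G≡G : ∀ x y → G x ≡ G y mod⟨ ι x - ι y ∷ [ + s ] ⟩
  G≡G = proj₁ (proj₂ lifted)
  G≡F : ∀ x → G x ≡ F x mod⟨ + m ∷ [ + s ] ⟩
  G≡F = proj₂ (proj₂ lifted)
  g : ZMod r → ZMod s
  g x = reduce s (G x)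
  g≡G : ∀ x → ι (g x) ≡ G x mod⟨ [ + s ] ⟩
  g≡G x = ι-reduce (G x)
  g≡g : ∀ x y → ι (g x) ≡ ι (g y) mod⟨ ι x - ι y ∷ [ + s ] ⟩
  g≡g x y = begin
    ι (g x)  ≈⟨ mod-mono ⊑-cons (g≡G x) ⟩
    G x      ≈⟨ G≡G x y ⟩
    G y      ≈⟨ mod-mono ⊑-cons (g≡G y) ⟨
    ι (g y)  ∎
    where open SetoidReasoning (mod-setoid (ι x - ι y ∷ [ + s ]))
  g-lifts-f : ∀ x → πab s m (g x) ≡ f (πab r n x)
  g-lifts-f x = ι-injective-mod (begin
    ι (πab s m (g x))  ≈⟨ ι-πab (g x) ⟩
    ι (g x)            ≈⟨ mod-∣ m∣s (g≡G x) ⟩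
    G x                ≈⟨ mod-mono (⊑-absorb (∣ᵤ⇒∣ m∣s)) (G≡F x) ⟩
    F x                ∎)
    where open SetoidReasoning (mod-setoid [ + m ])
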